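{- Every maximal clique-partition $\mathcal{P}$ of $G$ is produced by a single configuration from $\mathit{Leaf}(\mathbb{T}^S_{!(T1,T2)}(G))$, i.e., there is exactly one $\mathit{cfg}\in\mathit{Leaf}(\mathbb{T}^S_{!(T1,T2)}(G))$ with $\mathit{repr}(\mathit{cfg})=\mathcal{P}$.
   Context: Let $G=(V,E)$ be a finite undirected graph. A clique is a nonempty set of pairwise adjacent vertices; it is maximal if not properly contained in another clique. A clique-partition of $G$ is a partition of $V$ into cliques; it is maximal if it does not contain two different cliques $C,C'$ with $C\cup C'$ a clique. Fix an enumeration $\overline{C}_1,\ldots,\overline{C}_m$ of all maximal cliques of $G$. For $v\in V$ let $\mathit{cliques}(v):=\{i\in[m]\mid v\in\overline{C}_i\}$, $d(v):=|\mathit{cliques}(v)|$, and for nonempty $C\subseteq V$ let $\mathit{cliques}(C):=\bigcap_{v\in C}\mathit{cliques}(v)$. Let $\mathit{Rgd}:=\{k\in[m]\mid \exists v\in V,\ \mathit{cliques}(v)=\{k\}\}$. Fix an enumeration $S=[v_1,\ldots,v_s]$ of all vertices $v$ with $d(v)>1$. A configuration is a list $[C_1,\ldots,C_m]$ where each $C_i$ is empty or a clique, $C_i\subseteq\overline{C}_i$, and $\bigcup_i C_i=V$; $\mathit{repr}([C_1,\ldots,C_m]):=\{C_i\mid C_i\neq\emptyset\}$. Write $[C_1,\ldots,C_m]\to_{(v,i)}[C'_1,\ldots,C'_m]$ if $v\in C_i$, $C'_i=C_i$ and $C'_j=C_j\setminus\{v\}$ for $j\neq i$. The search tree $\mathbb{T}^S(G)$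 has root $[\overline{C}_1,\ldots,\overline{C}_m]$ at depth $0$; a node at depth $k<s$ carrying $\mathit{cfg}$ has, for each $i\in\mathit{cliques}(v_{k+1})$, a child at depth $k+1$ carrying $\mathit{cfg}'$ with $\mathit{cfg}\to_{(v_{k+1},i)}\mathit{cfg}'$. For a node reached by $\mathit{cfg}_0\to_{(v_1,i_1)}\cdots\to_{(v_\ell,i_\ell)}\mathit{cfg}$ set $\delta(\mathit{cfg}):=[i_1,\ldots,i_\ell]$. A node $\mathit{cfg}=[C_1,\ldots,C_m]$ with $\delta(\mathit{cfg})=[i_1,\ldots,i_\ell]$ is a $T1$-node if either (a) $\mathit{cliques}(C_a)\cap\mathit{Rgd}\neq\emptyset$ for some $a\in\{i_1,\ldots,i_\ell\}\setminus\mathit{Rgd}$, or (b) $\mathit{cliques}(C_a)\cap\mathit{cliques}(C_b)\neq\emptyset$ for distinct $a,b\in\{i_1,\ldots,i_\ell\}$. $\mathbb{T}^S_{!(T1)}(G)$ is obtained from $\mathbb{T}^S(G)$ by removing every subtree whose root is a $T1$-node. A node $\mathit{cfg}=[C_1,\ldots,C_m]$ of $\mathbb{T}^S_{!(T1)}(G)$ with $\delta(\mathit{cfg})=[i_1,\ldots,i_\ell]$ is a $T2$-node if there exist $1\le j<i\le m$ with $j\in\{i_1,\ldots,i_\ell\}\setminus\mathit{Rgd}$ and $i\in\mathit{cliques}(C_j)$. $\mathbb{T}^S_{!(T1,T2)}(G)$ is obtained from $\mathbb{T}^S_{!(T1)}(G)$ by removing every subtree whose root is a $T2$-node, and $\mathit{Leaf}(\mathbb{T}^S_{!(T1,T2)}(G))$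 is the set of configurations at depth $s$ in it. -}

module Defs where

open import Data.Nat using (ℕ; zero; suc; _≤_) renaming (_<_ to _<ℕ_)
open import Data.Fin using (Fin; _≟_; _<_)
open import Data.Fin.Subset using (Subset; _∈_; _⊆_; _∪_; _-_; Nonempty; ∣_∣)
open import Data.Fin.Subset.Properties using (_∈?_)
open import Data.Vec using (Vec; lookup; tabulate)
open import Data.List using (List; []; _∷_; length; take; zip)
open import Data.List.Membership.Propositional using () renaming (_∈_ to _∈L_)
open import Data.List.Relation.Unary.Unique.Propositional using (Unique)
open import Data.List.Relation.Binary.Pointwise using (Pointwise)
open import Data.Product using (Σ; ∃; ∃-syntax; _×_; _,_)
open import Data.Sum using (_⊎_)
open import Relation.Nullary using (¬_; does)
open import Relation.Binary using (Decidable)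
open import Relation.Binary.PropositionalEquality using (_≡_; _≢_)
open import Data.Bool using (if_then_else_)
open import Function.Bundles using (_⇔_)

record Graph : Set₁ where
  field
    n    : ℕ
    Adj  : Fin n → Fin n → Set
    sym  : ∀ {u v} → Adj u v → Adj v u
    adj? : Decidable Adj

module _ (G : Graph) where
  open Graph G

  IsClique : Subset n → Set
  IsClique C = Nonempty C × (∀ u v → u ∈ C → v ∈ C → u ≢ v → Adj u v)

  IsMaximalClique : Subset n → Set
  IsMaximalClique C = IsClique C × (∀ C' → IsClique C' → C ⊆ C' → C' ≡ C)

  -- a clique-partition, given as a (finite) set of subsets, presented by a list
  IsCliquePartition : List (Subset n) → Set
  IsCliquePartition P =
      (∀ C → C ∈L P → IsClique C)
    × (∀ C C' → C ∈L P → C' ∈L P → C ≢ C' → ∀ v → v ∈ C → v ∈ C' → ⊥')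
    × (∀ v → ∃[ C ] (C ∈L P × v ∈ C))
    where open import Data.Empty renaming (⊥ to ⊥')

  IsMaximalCliquePartition : List (Subset n) → Set
  IsMaximalCliquePartition P =
      IsCliquePartition P
    × (∀ C C' → C ∈L P → C' ∈L P → C ≢ C' → ¬ IsClique (C ∪ C'))

  IsMaxCliqueEnumeration : ∀ {m} → Vec (Subset n) m → Set
  IsMaxCliqueEnumeration {m} cl =
      (∀ i → IsMaximalClique (lookup cl i))
    × (∀ i j → lookup cl i ≡ lookup cl j → i ≡ j)
    × (∀ C → IsMaximalClique C → ∃[ i ] (lookup cl i ≡ C))

Config : ℕ → ℕ → Set
Config n m = Vec (Subset n) m

module Tree {n m : ℕ} (cl : Vec (Subset n) m) where

  cliques : Fin n → Subset m
  cliques v = tabulate (λ i → does (v ∈? lookup cl i))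

  d : Fin n → ℕ
  d v = ∣ cliques v ∣

  _∈cliquesOf_ : Fin m → Subset n → Set
  i ∈cliquesOf C = ∀ v → v ∈ C → i ∈ cliques v

  InRgd : Fin m → Set
  InRgd k = ∃[ v ] (∀ i → (i ∈ cliques v ⇔ i ≡ k))

  IsSEnumeration : List (Fin n) → Set
  IsSEnumeration S = Unique S × (∀ v → (v ∈L S ⇔ 1 <ℕ d v))

  root : Config n m
  root = cl

  -- cfg →_(v,i) cfg'   (the move; requires v ∈ C_i, guaranteed in the tree)
  move : Config n m → Fin n → Fin m → Config n m
  move cfg v i = tabulate (λ j → if does (j ≟ i) then lookup cfg j else (lookup cfg j - v))

  run : Config n m → List (Fin n × Fin m) → Config n m
  run cfg []            = cfg
  run cfg ((v , i) ∷ ps) = run (move cfg v i) ps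

  nodeCfg : List (Fin n) → List (Fin m) → Config n m
  nodeCfg S δ = run root (zip S δ)

  T1 : Config n m → List (Fin m) → Set
  T1 cfg δ =
      (∃[ a ] (a ∈L δ × ¬ InRgd a × ∃[ k ] (k ∈cliquesOf lookup cfg a × InRgd k)))
    ⊎ (∃[ a ] ∃[ b ] (a ∈L δ × b ∈L δ × a ≢ b
          × ∃[ k ] (k ∈cliquesOf lookup cfg a × k ∈cliquesOf lookup cfg b)))

  T2 : Config n m → List (Fin m) → Set
  T2 cfg δ = ∃[ j ] ∃[ i ] (j < i × j ∈L δ × ¬ InRgd j × i ∈cliquesOf lookup cfg j)

  ValidPath : List (Fin n) → List (Fin m) → Set
  ValidPath S δ = Pointwise (λ v i → i ∈ cliques v) S δ

  -- the leaf with path δ survives in 𝕋^S_{!(T1,T2)}(G):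
  -- no node on its root path (root and leaf included) is a T1- or T2-node
  Survives : List (Fin n) → List (Fin m) → Set
  Survives S δ = ∀ k → k ≤ length S →
      ¬ T1 (nodeCfg (take k S) (take k δ)) (take k δ)
    × ¬ T2 (nodeCfg (take k S) (take k δ)) (take k δ)

  InLeaf : List (Fin n) → Config n m → Set
  InLeaf S cfg = ∃[ δ ] (ValidPath S δ × Survives S δ × nodeCfg S δ ≡ cfg)

  _∈repr_ : Subset n → Config n m → Set
  C ∈repr cfg = ∃[ i ] (lookup cfg i ≡ C × Nonempty C)

  ReprEq : Config n m → List (Subset n) → Set
  ReprEq cfg P = ∀ C → (C ∈repr cfg ⇔ C ∈L P)

module Submission where

-- Let block w be the block of P containing w and top w the largest index of a maximal clique
-- containing block w. Choosing top v for every v of S leads to a leaf whose nonempty cliques are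
-- exactly the blocks of P. No node on the way is a T1-node, because by maximality of P two
-- distinct blocks never lie in a common maximal clique, and none is a T2-node, because top is the
-- largest choice. Conversely, let a surviving leaf represent P and let w lie in its j-th clique.
-- That clique is block w, so j ≤ top w. If j < top w, then w ∈ S (otherwise w lies in only one
-- maximal clique), so j was chosen on the path, and j is not rigid: a rigid vertex u of j is
-- never moved, hence lies in block w, which is contained in maximal clique top w, forcing
-- top w = j. So the leaf would be a T2-node. Hence j = top w, and the leaf is the canonical one.

open import Defs
open import Data.Nat using (ℕ; zero; suc; z≤n; s≤s; _+_) renaming (_≤_ to _≤ℕ_; _<_ to _<ℕ_)
import Data.Nat.Properties as ℕ
open import Data.Fin using (Fin; zero; suc; _≟_; _≤_; _<_)
open import Data.Fin.Properties using (any?; all?) renaming (≤-antisym to ≤F-antisym; <-irrefl to <F-irrefl)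
open import Data.Fin.Subset using (Subset; _∈_; _∉_; _⊆_; _∪_; _-_; _─_; ⁅_⁆; Nonempty; ∣_∣)
open import Data.Fin.Subset.Properties
open import Data.Vec using (Vec; _∷_; here; there; lookup)
open import Data.Vec.Properties using (lookup∘tabulate; tabulate∘lookup; tabulate-cong; []=⇒lookup; lookup⇒[]=; ≡-dec)
open import Data.Bool using (if_then_else_)
import Data.Bool as Bool
open import Data.List using (List; []; _∷_; length; take; zip; map)
open import Data.List.Properties using (take-map; take-all)
open import Data.List.Membership.Propositional using () renaming (_∈_ to _∈L_; _∉_ to _∉L_)
open import Data.List.Membership.Propositional.Properties using (∈-map⁻)
open import Data.List.Relation.Unary.Any using (here; there)
open import Data.List.Relation.Binary.Pointwise using (Pointwise; []; _∷_)
open import Data.List.Relation.Binary.Pointwise.Properties using (Pointwise-length)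
open import Data.Product using (∃; ∃-syntax; _×_; _,_; proj₁; proj₂)
open import Data.Sum using (inj₁; inj₂; [_,_]′)
open import Data.Empty using (⊥; ⊥-elim)
open import Relation.Nullary using (¬_; Dec; yes; no; does; contradiction)
open import Relation.Nullary.Decidable using (_×-dec_; _→-dec_; ¬?; dec-true)
open import Relation.Unary using (Pred; Decidable)
open import Relation.Binary.PropositionalEquality using (_≡_; _≢_; refl; sym; trans; cong; subst; subst₂)
open import Function.Bundles using (_⇔_; mk⇔; Equivalence)
open Equivalence using (to; from)

private variable k : ℕ

∣p∣≤1⇒x≡y : {p : Subset k} {x y : Fin k} → ∣ p ∣ ≤ℕ 1 → x ∈ p → y ∈ p → x ≡ y
∣p∣≤1⇒x≡y {p = p} {x} {y} ∣p∣≤1 x∈p y∈p with x ≟ y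
... | yes x≡y = x≡y
... | no x≢y = contradiction ∣p∣≤1 (ℕ.<⇒≱ (begin-strict
    1           ≡⟨ sym (∣⁅x⁆∣≡1 y) ⟩
    ∣ ⁅ y ⁆ ∣   ≤⟨ p⊆q⇒∣p∣≤∣q∣ ⁅y⁆⊆p-x ⟩
    ∣ p - x ∣   <⟨ x∈p⇒∣p-x∣<∣p∣ x∈p ⟩
    ∣ p ∣       ∎))
  where
  open ℕ.≤-Reasoning
  ⁅y⁆⊆p-x : ⁅ y ⁆ ⊆ p - x
  ⁅y⁆⊆p-x z∈⁅y⁆ with refl ← x∈⁅y⁆⇒x≡y y z∈⁅y⁆ = x∈p∧x≢y⇒x∈p-y y∈p (λ y≡x → x≢y (sym y≡x))

p⊆⁅x⁆⇒∣p∣≤1 : {p : Subset k} (x : Fin k) → p ⊆ ⁅ x ⁆ → ∣ p ∣ ≤ℕ 1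
p⊆⁅x⁆⇒∣p∣≤1 x p⊆⁅x⁆ = subst (_ ≤ℕ_) (∣⁅x⁆∣≡1 x) (p⊆q⇒∣p∣≤∣q∣ p⊆⁅x⁆)

∃⟶greatest : ∀ {ℓ} (P : Pred (Fin k) ℓ) → Decidable P → ∃ P → ∃ λ i → P i × (∀ j → P j → j ≤ i)
∃⟶greatest {zero}  P P? (() , _)
∃⟶greatest {suc k} P P? (i , Pi) with any? (λ j → P? (suc j))
... | yes ∃P∘suc with j , Pj , j-greatest ← ∃⟶greatest (λ j → P (suc j)) (λ j → P? (suc j)) ∃P∘suc =
  suc j , Pj , λ { zero _ → z≤n ; (suc j') Pj' → s≤s (j-greatest j' Pj') }
... | no ¬∃P∘suc = zero , P0 i Pi , λ { zero _ → z≤n ; (suc j) Pj → contradiction (j , Pj) ¬∃P∘suc }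
  where
  P0 : ∀ i → P i → P zero
  P0 zero    Pi = Pi
  P0 (suc i) Pi = contradiction (i , Pi) ¬∃P∘suc

x∈p─q⇒x∉q : ∀ (p q : Subset k) {x} → x ∈ p ─ q → x ∉ q
x∈p─q⇒x∉q (_ ∷ p) (_ ∷ q) (there x∈) (there x∈q) = x∈p─q⇒x∉q p q x∈ x∈q

lookup-ext : ∀ {a} {A : Set a} (xs ys : Vec A k) → (∀ i → lookup xs i ≡ lookup ys i) → xs ≡ ys
lookup-ext xs ys eq = trans (sym (tabulate∘lookup xs)) (trans (tabulate-cong eq) (tabulate∘lookup ys))

module _ {a b} {A : Set a} {B : Set b} where

  ∈-zip⁻ˡ : ∀ {xs : List A} {ys : List B} {x y} → (x , y) ∈L zip xs ys → x ∈L xs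
  ∈-zip⁻ˡ {_ ∷ _} {_ ∷ _} (here refl) = here refl
  ∈-zip⁻ˡ {_ ∷ _} {_ ∷ _} (there x,y∈) = there (∈-zip⁻ˡ x,y∈)

  ∈-zip⁻ʳ : ∀ {xs : List A} {ys : List B} {x y} → (x , y) ∈L zip xs ys → y ∈L ys
  ∈-zip⁻ʳ {_ ∷ _} {_ ∷ _} (here refl) = here refl
  ∈-zip⁻ʳ {_ ∷ _} {_ ∷ _} (there x,y∈) = there (∈-zip⁻ʳ x,y∈)

  ∈-zip-map⁻ : ∀ (f : A → B) xs {x y} → (x , y) ∈L zip xs (map f xs) → y ≡ f x
  ∈-zip-map⁻ f (_ ∷ _)  (here refl)  = refl
  ∈-zip-map⁻ f (_ ∷ xs) (there x,y∈) = ∈-zip-map⁻ f xs x,y∈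

  ∈-zip-map⁺ : ∀ (f : A → B) xs {x} → x ∈L xs → (x , f x) ∈L zip xs (map f xs)
  ∈-zip-map⁺ f (_ ∷ _)  (here refl) = here refl
  ∈-zip-map⁺ f (_ ∷ xs) (there x∈)  = there (∈-zip-map⁺ f xs x∈)

  Pointwise-∈-zip : ∀ {r} {R : A → B → Set r} {xs ys x} → Pointwise R xs ys → x ∈L xs →
    ∃[ y ] (x , y) ∈L zip xs ys
  Pointwise-∈-zip (_ ∷ _)  (here refl) = _ , here refl
  Pointwise-∈-zip (_ ∷ rs) (there x∈) with y , x,y∈ ← Pointwise-∈-zip rs x∈ = y , there x,y∈

module _ (G : Graph) where
  open Graph G using (n; Adj; adj?) renaming (sym to Adj-sym)

  private
    Extends : Subset n → Fin n → Set
    Extends C w = w ∉ C × (∀ u → u ∈ C → Adj u w)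

    extends? : ∀ C → Dec (∃ (Extends C))
    extends? C = any? (λ w → ¬? (w ∈? C) ×-dec all? (λ u → (u ∈? C) →-dec adj? u w))

    unextendable⇒maximal : ∀ {C} → IsClique G C → ¬ ∃ (Extends C) → IsMaximalClique G C
    unextendable⇒maximal {C} C-clique ¬ext = C-clique , λ C' C'-clique C⊆C' → ⊆-antisym (C'⊆C C'-clique C⊆C') C⊆C'
      where
      C'⊆C : ∀ {C'} → IsClique G C' → C ⊆ C' → C' ⊆ C
      C'⊆C {_} (_ , adj') C⊆C' {w} w∈C' with w ∈? C
      ... | yes w∈C = w∈C
      ... | no  w∉C = contradiction
        (w , w∉C , λ u u∈C → adj' u w (C⊆C' u∈C) w∈C' (λ { refl → w∉C u∈C })) ¬ext

    extend : ∀ {C w} → IsClique G C → Extends C w → IsClique G (C ∪ ⁅ w ⁆)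
    extend {C} {w} ((u , u∈C) , adj) (w∉C , w-adj) = (u , p⊆p∪q ⁅ w ⁆ u∈C) , adj'
      where
      adj' : ∀ u v → u ∈ C ∪ ⁅ w ⁆ → v ∈ C ∪ ⁅ w ⁆ → u ≢ v → Adj u v
      adj' u v u∈ v∈ u≢v with x∈p∪q⁻ C ⁅ w ⁆ u∈ | x∈p∪q⁻ C ⁅ w ⁆ v∈
      ... | inj₁ u∈C | inj₁ v∈C = adj u v u∈C v∈C u≢v
      ... | inj₁ u∈C | inj₂ v∈w with refl ← x∈⁅y⁆⇒x≡y w v∈w = w-adj u u∈C
      ... | inj₂ u∈w | inj₁ v∈C with refl ← x∈⁅y⁆⇒x≡y w u∈w = Adj-sym (w-adj v v∈C)
      ... | inj₂ u∈w | inj₂ v∈w = contradiction (trans (x∈⁅y⁆⇒x≡y w u∈w) (sym (x∈⁅y⁆⇒x≡y w v∈w))) u≢v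

    ∣C∣<∣C∪⁅w⁆∣ : ∀ {C : Subset n} {w} → w ∉ C → ∣ C ∣ <ℕ ∣ C ∪ ⁅ w ⁆ ∣
    ∣C∣<∣C∪⁅w⁆∣ {C} {w} w∉C = p⊂q⇒∣p∣<∣q∣ (p⊆p∪q {p = C} ⁅ w ⁆ , w , q⊆p∪q C ⁅ w ⁆ (x∈⁅x⁆ w) , w∉C)

    -- The fuel k bounds the number of vertices that can still be added.
    grow : (k : ℕ) {C : Subset n} → IsClique G C → n ≤ℕ ∣ C ∣ + k →
      ∃[ D ] (C ⊆ D × IsMaximalClique G D)
    grow k {C} C-clique n≤ with extends? C
    ... | no ¬ext = C , (λ w∈C → w∈C) , unextendable⇒maximal C-clique ¬ext
    grow zero {C} C-clique n≤ | yes (w , w∉C , _) = contradiction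
      (ℕ.≤-trans (∣p∣≤n (C ∪ ⁅ w ⁆)) (subst (n ≤ℕ_) (ℕ.+-identityʳ ∣ C ∣) n≤)) (ℕ.<⇒≱ (∣C∣<∣C∪⁅w⁆∣ {C} w∉C))
    grow (suc k) {C} C-clique n≤ | yes (w , ext)
      with D , C∪w⊆D , D-max ← grow k (extend C-clique ext)
             (ℕ.≤-trans n≤ (ℕ.≤-trans (ℕ.≤-reflexive (ℕ.+-suc ∣ C ∣ k)) (ℕ.+-monoˡ-≤ k (∣C∣<∣C∪⁅w⁆∣ (proj₁ ext)))))
      = D , (λ w∈C → C∪w⊆D (p⊆p∪q ⁅ w ⁆ w∈C)) , D-max

  ⊆-clique : ∀ {C D} → Nonempty C → C ⊆ D → IsClique G D → IsClique G C
  ⊆-clique C≢∅ C⊆D (_ , adj) = C≢∅ , λ u v u∈C v∈C → adj u v (C⊆D u∈C) (C⊆D v∈C)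

  clique⊆maximalClique : ∀ {C} → IsClique G C → ∃[ D ] (C ⊆ D × IsMaximalClique G D)
  clique⊆maximalClique {C} C-clique = grow n C-clique (ℕ.m≤n+m n ∣ C ∣)

module TreeProperties {n m : ℕ} (cl : Vec (Subset n) m) where
  open Tree cl

  ∈cliques⇒∈cl : ∀ {v i} → i ∈ cliques v → v ∈ lookup cl i
  ∈cliques⇒∈cl {v} {i} i∈ with v ∈? lookup cl i | trans (sym (lookup∘tabulate _ i)) ([]=⇒lookup i∈)
  ... | yes v∈ | _ = v∈
  ... | no _   | ()

  ∈cl⇒∈cliques : ∀ {v i} → v ∈ lookup cl i → i ∈ cliques v
  ∈cl⇒∈cliques {v} {i} v∈ = lookup⇒[]= i (cliques v) (trans (lookup∘tabulate _ i) (dec-true (v ∈? lookup cl i) v∈))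

  ∉S⇒unique-clique : ∀ {S w i j} → IsSEnumeration S → w ∉L S →
    w ∈ lookup cl i → w ∈ lookup cl j → i ≡ j
  ∉S⇒unique-clique {w = w} (_ , S⇔) w∉S w∈i w∈j = ∣p∣≤1⇒x≡y {p = cliques w}
    (ℕ.≮⇒≥ (λ 1<d → w∉S (from (S⇔ w) 1<d))) (∈cl⇒∈cliques w∈i) (∈cl⇒∈cliques w∈j)

  rigid⇒∉S : ∀ {S u j} → IsSEnumeration S → (∀ i → i ∈ cliques u ⇔ i ≡ j) → u ∉L S
  rigid⇒∉S {u = u} {j} (_ , S⇔) u-rigid u∈S = ℕ.<⇒≱ (to (S⇔ u) u∈S)
    (p⊆⁅x⁆⇒∣p∣≤1 {p = cliques u} j (λ {i} i∈ → subst (_∈ ⁅ j ⁆) (sym (to (u-rigid i) i∈)) (x∈⁅x⁆ j)))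

  MovesTo : List (Fin n × Fin m) → Fin n → Fin m → Set
  MovesTo ps w j = ∀ {i} → (w , i) ∈L ps → i ≡ j

  private
    -- The function tabulated by Tree.move, so that lookup∘tabulate applies to it.
    moved : Config n m → Fin n → Fin m → Fin m → Subset n
    moved cfg v i j = if does (j ≟ i) then lookup cfg j else (lookup cfg j - v)

    ∈-moved⁻ : ∀ (C : Subset n) {v w : Fin n} {i j : Fin m} (j≟i : Dec (j ≡ i)) →
      w ∈ (if does j≟i then C else C - v) → w ∈ C × (v ≡ w → i ≡ j)
    ∈-moved⁻ C (yes j≡i) w∈ = w∈ , λ _ → sym j≡i
    ∈-moved⁻ C {v} (no _) w∈ = p─q⊆p C ⁅ v ⁆ w∈ , λ { refl → ⊥-elim (x∈p─q⇒x∉q C ⁅ v ⁆ w∈ (x∈⁅x⁆ v)) }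

    ∈-moved⁺ : ∀ (C : Subset n) {v w : Fin n} {i j : Fin m} (j≟i : Dec (j ≡ i)) →
      w ∈ C → (v ≡ w → i ≡ j) → w ∈ (if does j≟i then C else C - v)
    ∈-moved⁺ C (yes _)   w∈ _        = w∈
    ∈-moved⁺ C (no j≢i) w∈ v≡w⇒i≡j = x∈p∧x≢y⇒x∈p-y w∈ (λ { refl → j≢i (sym (v≡w⇒i≡j refl)) })

  ∈-run⁻ : ∀ cfg ps {j w} → w ∈ lookup (run cfg ps) j → w ∈ lookup cfg j × MovesTo ps w j
  ∈-run⁻ cfg [] w∈ = w∈ , λ ()
  ∈-run⁻ cfg ((v , i) ∷ ps) {j} {w} w∈ =
    let w∈moved , moves   = ∈-run⁻ (move cfg v i) ps w∈
        w∈cfg , v≡w⇒i≡j = ∈-moved⁻ (lookup cfg j) (j ≟ i)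
                              (subst (w ∈_) (lookup∘tabulate (moved cfg v i) j) w∈moved)
    in w∈cfg , λ { (here refl) → v≡w⇒i≡j refl ; (there w,i∈) → moves w,i∈ }

  ∈-run⁺ : ∀ cfg ps {j w} → w ∈ lookup cfg j → MovesTo ps w j → w ∈ lookup (run cfg ps) j
  ∈-run⁺ cfg [] w∈ _ = w∈
  ∈-run⁺ cfg ((v , i) ∷ ps) {j} {w} w∈ moves = ∈-run⁺ (move cfg v i) ps
    (subst (w ∈_) (sym (lookup∘tabulate (moved cfg v i) j))
      (∈-moved⁺ (lookup cfg j) (j ≟ i) w∈ λ { refl → moves (here refl) }))
    (λ w,i∈ → moves (there w,i∈))

  ∈-nodeCfg⇒∈cl : ∀ {S δ w j} → w ∈ lookup (nodeCfg S δ) j → w ∈ lookup cl j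
  ∈-nodeCfg⇒∈cl {S} {δ} w∈ = proj₁ (∈-run⁻ root (zip S δ) w∈)

  ∉⇒∈-nodeCfg : ∀ {S δ w j} → w ∉L S → w ∈ lookup cl j → w ∈ lookup (nodeCfg S δ) j
  ∉⇒∈-nodeCfg w∉S w∈ = ∈-run⁺ root _ w∈ (λ w,i∈ → contradiction (∈-zip⁻ˡ w,i∈) w∉S)

  ∈-nodeCfg⇒∈path : ∀ {S δ w j} → ValidPath S δ → w ∈L S → w ∈ lookup (nodeCfg S δ) j → j ∈L δ
  ∈-nodeCfg⇒∈path valid w∈S w∈ with i , w,i∈ ← Pointwise-∈-zip valid w∈S =
    subst (_∈L _) (proj₂ (∈-run⁻ root _ w∈) w,i∈) (∈-zip⁻ʳ w,i∈)

  Survives⇒leaf-¬T2 : ∀ {S δ} → ValidPath S δ → Survives S δ → ¬ T2 (nodeCfg S δ) δ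
  Survives⇒leaf-¬T2 {S} {δ} valid survives = subst₂ (λ S′ δ′ → ¬ T2 (nodeCfg S′ δ′) δ′)
    (take-all (length S) S ℕ.≤-refl) (take-all (length S) δ (ℕ.≤-reflexive (sym (Pointwise-length valid))))
    (proj₂ (survives (length S) ℕ.≤-refl))

module Blocks (G : Graph) {m : ℕ} (cl : Vec (Subset (Graph.n G)) m) (enum : IsMaxCliqueEnumeration G cl)
  (P : List (Subset (Graph.n G))) (part : IsMaximalCliquePartition G P) where
  open Graph G using (n)
  open Tree cl
  open TreeProperties cl

  private
    P-clique : ∀ {C} → C ∈L P → IsClique G C
    P-clique = proj₁ (proj₁ part) _

    P-disjoint : ∀ {C C'} → C ∈L P → C' ∈L P → C ≢ C' → ∀ w → w ∈ C → w ∈ C' → ⊥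
    P-disjoint = proj₁ (proj₂ (proj₁ part)) _ _

    P-covers : ∀ w → ∃[ C ] (C ∈L P × w ∈ C)
    P-covers = proj₂ (proj₂ (proj₁ part))

    P-maximal : ∀ {C C'} → C ∈L P → C' ∈L P → C ≢ C' → ¬ IsClique G (C ∪ C')
    P-maximal = proj₂ part _ _

    _≟ₛ_ : (C D : Subset n) → Dec (C ≡ D)
    _≟ₛ_ = ≡-dec Bool._≟_

  block : Fin n → Subset n
  block w = proj₁ (P-covers w)

  block∈P : ∀ w → block w ∈L P
  block∈P w = proj₁ (proj₂ (P-covers w))

  ∈block : ∀ w → w ∈ block w
  ∈block w = proj₂ (proj₂ (P-covers w))

  block-unique : ∀ {C w} → C ∈L P → w ∈ C → C ≡ block w
  block-unique {C} {w} C∈P w∈C with C ≟ₛ block w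
  ... | yes C≡block = C≡block
  ... | no  C≢block = ⊥-elim (P-disjoint C∈P (block∈P w) C≢block w w∈C (∈block w))

  ⊆-same-clique⇒≡ : ∀ {C C' k} → C ∈L P → C' ∈L P → C ⊆ lookup cl k → C' ⊆ lookup cl k → C ≡ C'
  ⊆-same-clique⇒≡ {C} {C'} {k} C∈P C'∈P C⊆ C'⊆ with C ≟ₛ C'
  ... | yes C≡C' = C≡C'
  ... | no  C≢C' = ⊥-elim (P-maximal C∈P C'∈P C≢C' C∪C'-clique)
    where
    C∪C'-clique : IsClique G (C ∪ C')
    C∪C'-clique = let w , w∈C = proj₁ (P-clique C∈P) in
      ⊆-clique G (w , p⊆p∪q C' w∈C) (λ x∈ → [ C⊆ , C'⊆ ]′ (x∈p∪q⁻ C C' x∈)) (proj₁ (proj₁ enum k))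

  private
    block⊆maximalClique : ∀ w → ∃[ i ] (block w ⊆ lookup cl i)
    block⊆maximalClique w =
      let D , block⊆D , D-maximal = clique⊆maximalClique G (P-clique (block∈P w))
          i , cl-i≡D              = proj₂ (proj₂ enum) D D-maximal
      in i , λ x∈ → subst (_ ∈_) (sym cl-i≡D) (block⊆D x∈)

    top-spec : ∀ w → ∃ λ i → block w ⊆ lookup cl i × (∀ j → block w ⊆ lookup cl j → j ≤ i)
    top-spec w = ∃⟶greatest (λ i → block w ⊆ lookup cl i) (λ i → block w ⊆? lookup cl i) (block⊆maximalClique w)

  top : Fin n → Fin m
  top w = proj₁ (top-spec w)

  block⊆top : ∀ w → block w ⊆ lookup cl (top w)
  block⊆top w = proj₁ (proj₂ (top-spec w))

  top-greatest : ∀ {w j} → block w ⊆ lookup cl j → j ≤ top w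
  top-greatest {w} {j} = proj₂ (proj₂ (top-spec w)) j

  ∈cl-top : ∀ w → w ∈ lookup cl (top w)
  ∈cl-top w = block⊆top w (∈block w)

  ∈block⇒top≡ : ∀ {w v} → w ∈ block v → top w ≡ top v
  ∈block⇒top≡ {w} {v} w∈ = ≤F-antisym
    (top-greatest (subst (_⊆ lookup cl (top w)) (sym block-v≡block-w) (block⊆top w)))
    (top-greatest (subst (_⊆ lookup cl (top v)) block-v≡block-w (block⊆top v)))
    where
    block-v≡block-w : block v ≡ block w
    block-v≡block-w = block-unique (block∈P v) w∈

  top≡⇒∈block : ∀ {w v} → top w ≡ top v → w ∈ block v
  top≡⇒∈block {w} {v} top≡ = subst (w ∈_)
    (⊆-same-clique⇒≡ (block∈P w) (block∈P v) (subst (λ i → block w ⊆ lookup cl i) top≡ (block⊆top w)) (block⊆top v))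
    (∈block w)

  ⊆-same-clique⇒top≡ : ∀ {v v' k} → block v ⊆ lookup cl k → block v' ⊆ lookup cl k → top v ≡ top v'
  ⊆-same-clique⇒top≡ {v} {v'} ⊆k ⊆k' =
    ∈block⇒top≡ (subst (v ∈_) (⊆-same-clique⇒≡ (block∈P v) (block∈P v') ⊆k ⊆k') (∈block v))

  module CanonicalLeaf (S : List (Fin n)) (S-enum : IsSEnumeration S) where
    open import Data.List.Membership.DecPropositional (_≟_ {n}) using () renaming (_∈?_ to _∈L?_)

    node : List (Fin n) → Config n m
    node L = nodeCfg L (map top L)

    ∈-node⁺ : ∀ L {w j} → w ∈ lookup cl j → (w ∈L L → top w ≡ j) → w ∈ lookup (node L) j
    ∈-node⁺ L w∈ top≡ = ∈-run⁺ root _ w∈ (λ w,i∈ → trans (∈-zip-map⁻ top L w,i∈) (top≡ (∈-zip⁻ˡ w,i∈)))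

    ∈-node⁻ : ∀ L {w j} → w ∈ lookup (node L) j → w ∈ lookup cl j × (w ∈L L → top w ≡ j)
    ∈-node⁻ L w∈ = let w∈cl , moves = ∈-run⁻ root _ w∈ in w∈cl , λ w∈L → moves (∈-zip-map⁺ top L w∈L)

    block⊆node : ∀ L v → block v ⊆ lookup (node L) (top v)
    block⊆node L v w∈ = ∈-node⁺ L (block⊆top v w∈) (λ _ → ∈block⇒top≡ w∈)

    ∈cliquesOf-node⇒block⊆ : ∀ L {v k} → k ∈cliquesOf lookup (node L) (top v) → block v ⊆ lookup cl k
    ∈cliquesOf-node⇒block⊆ L {v} k∈ w∈ = ∈cliques⇒∈cl (k∈ _ (block⊆node L v w∈))

    ∈cliquesOf-node∧rigid⇒top≡ : ∀ L {v k u} → k ∈cliquesOf lookup (node L) (top v) →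
      (∀ i → i ∈ cliques u ⇔ i ≡ k) → top v ≡ k
    ∈cliquesOf-node∧rigid⇒top≡ L {k = k} {u} k∈ u-rigid =
      trans (⊆-same-clique⇒top≡ (∈cliquesOf-node⇒block⊆ L k∈) block-u⊆k) top-u≡k
      where
      top-u≡k : top u ≡ k
      top-u≡k = to (u-rigid (top u)) (∈cl⇒∈cliques (∈cl-top u))
      block-u⊆k : block u ⊆ lookup cl k
      block-u⊆k = subst (λ i → block u ⊆ lookup cl i) top-u≡k (block⊆top u)

    node-¬T1 : ∀ L → ¬ T1 (node L) (map top L)
    node-¬T1 L (inj₁ (a , a∈ , a-not-rigid , k , k∈ , u , u-rigid)) with v , _ , refl ← ∈-map⁻ top a∈ =
      a-not-rigid (subst InRgd (sym (∈cliquesOf-node∧rigid⇒top≡ L {u = u} k∈ u-rigid)) (u , u-rigid))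
    node-¬T1 L (inj₂ (a , b , a∈ , b∈ , a≢b , k , k∈a , k∈b))
      with v , _ , refl ← ∈-map⁻ top a∈ | v' , _ , refl ← ∈-map⁻ top b∈ =
      a≢b (⊆-same-clique⇒top≡ (∈cliquesOf-node⇒block⊆ L k∈a) (∈cliquesOf-node⇒block⊆ L k∈b))

    node-¬T2 : ∀ L → ¬ T2 (node L) (map top L)
    node-¬T2 L (j , i , j<i , j∈ , _ , i∈) with v , _ , refl ← ∈-map⁻ top j∈ =
      ℕ.<⇒≱ j<i (top-greatest (∈cliquesOf-node⇒block⊆ L i∈))

    canonical : Config n m
    canonical = node S

    top-valid : ∀ L → ValidPath L (map top L)
    top-valid []      = []
    top-valid (v ∷ L) = ∈cl⇒∈cliques (∈cl-top v) ∷ top-valid L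

    top-survives : Survives S (map top S)
    top-survives k _ rewrite take-map {f = top} k S = node-¬T1 (take k S) , node-¬T2 (take k S)

    canonical∈Leaf : InLeaf S canonical
    canonical∈Leaf = map top S , top-valid S , top-survives , refl

    ∈canonical⁺ : ∀ {w j} → top w ≡ j → w ∈ lookup canonical j
    ∈canonical⁺ {w} refl = ∈-node⁺ S (∈cl-top w) (λ _ → refl)

    ∈canonical⁻ : ∀ {w j} → w ∈ lookup canonical j → top w ≡ j
    ∈canonical⁻ {w} w∈ with w ∈L? S
    ... | yes w∈S = proj₂ (∈-node⁻ S w∈) w∈S
    ... | no  w∉S = ∉S⇒unique-clique S-enum w∉S (∈cl-top w) (proj₁ (∈-node⁻ S w∈))

    canonical-top : ∀ v → lookup canonical (top v) ≡ block v
    canonical-top v = ⊆-antisym (λ w∈ → top≡⇒∈block (∈canonical⁻ w∈)) (λ w∈ → ∈canonical⁺ (∈block⇒top≡ w∈))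

    canonical-repr : ReprEq canonical P
    canonical-repr C = mk⇔
      (λ { (j , refl , w , w∈) →
             subst (_∈L P) (trans (sym (canonical-top w)) (cong (lookup canonical) (∈canonical⁻ w∈))) (block∈P w) })
      (λ C∈P → let w , w∈C = proj₁ (P-clique C∈P) in
        top w , trans (canonical-top w) (sym (block-unique C∈P w∈C)) , w , w∈C)

    module _ {δ} (valid : ValidPath S δ) (survives : Survives S δ) (repr : ReprEq (nodeCfg S δ) P) where

      private
        leaf : Config n m
        leaf = nodeCfg S δ

      ∈leaf⇒≡block : ∀ {w j} → w ∈ lookup leaf j → lookup leaf j ≡ block w
      ∈leaf⇒≡block w∈ = block-unique (to (repr _) (_ , refl , _ , w∈)) w∈

      ∈leaf⇒≤top : ∀ {w j} → w ∈ lookup leaf j → j ≤ top w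
      ∈leaf⇒≤top w∈ = top-greatest (λ y∈ → ∈-nodeCfg⇒∈cl {S} {δ} (subst (_ ∈_) (sym (∈leaf⇒≡block w∈)) y∈))

      ∈leaf⇒≮top : ∀ {w j} → w ∈ lookup leaf j → ¬ j < top w
      ∈leaf⇒≮top {w} {j} w∈ j<top with w ∈L? S
      ... | no  w∉S = <F-irrefl (∉S⇒unique-clique S-enum w∉S (∈-nodeCfg⇒∈cl {S} {δ} w∈) (∈cl-top w)) j<top
      ... | yes w∈S = Survives⇒leaf-¬T2 valid survives
          (j , top w , j<top , ∈-nodeCfg⇒∈path valid w∈S w∈ , j-not-rigid , top∈cliquesOf)
        where
        top∈cliquesOf : top w ∈cliquesOf lookup leaf j
        top∈cliquesOf y y∈ = ∈cl⇒∈cliques (block⊆top w (subst (y ∈_) (∈leaf⇒≡block w∈) y∈))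

        j-not-rigid : ¬ InRgd j
        j-not-rigid (u , u-rigid) = <F-irrefl (sym (to (u-rigid (top w)) (top∈cliquesOf u u∈leaf))) j<top
          where
          u∈leaf : u ∈ lookup leaf j
          u∈leaf = ∉⇒∈-nodeCfg (rigid⇒∉S S-enum u-rigid) (∈cliques⇒∈cl (from (u-rigid j) refl))

      ∈leaf⇒top≡ : ∀ {w j} → w ∈ lookup leaf j → top w ≡ j
      ∈leaf⇒top≡ w∈ = ≤F-antisym (ℕ.≮⇒≥ (∈leaf⇒≮top w∈)) (∈leaf⇒≤top w∈)

      leaf≡canonical : leaf ≡ canonical
      leaf≡canonical = lookup-ext leaf canonical λ j →
        ⊆-antisym (λ w∈ → ∈canonical⁺ (∈leaf⇒top≡ w∈)) (λ w∈ → canonical⊆leaf (∈canonical⁻ w∈))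
        where
        canonical⊆leaf : ∀ {w j} → top w ≡ j → w ∈ lookup leaf j
        canonical⊆leaf {w} refl =
          let i , leaf-i≡block , _ = from (repr (block w)) (block∈P w)
              w∈leaf-i = subst (w ∈_) (sym leaf-i≡block) (∈block w)
          in subst (λ k → w ∈ lookup leaf k) (sym (∈leaf⇒top≡ w∈leaf-i)) w∈leaf-i

corollary3 : (G : Graph) {m : ℕ} (cl : Vec (Subset (Graph.n G)) m)
    → IsMaxCliqueEnumeration G cl
    → (S : List (Fin (Graph.n G))) → Tree.IsSEnumeration cl S
    → (P : List (Subset (Graph.n G))) → IsMaximalCliquePartition G P
    → ∃[ cfg ] ((Tree.InLeaf cl S cfg × Tree.ReprEq cl cfg P)
        × (∀ cfg' → Tree.InLeaf cl S cfg' → Tree.ReprEq cl cfg' P → cfg' ≡ cfg))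
corollary3 G cl enum S S-enum P part =
  canonical , (canonical∈Leaf , canonical-repr) ,
  λ { _ (δ , valid , survives , refl) repr → leaf≡canonical valid survives repr }
  where
  open Blocks G cl enum P part
  open CanonicalLeaf S S-enum
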